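{- Let $u$ and $v$ be double occurrence words with no common letters and let $w=uv$ (their concatenation), with $|w|=2n$. Then $w$ is not maximal, i.e. $|\mathcal{C}(\Gamma_w)|\neq F_{2n+1}-1$.
   Context: A double occurrence word is a non-empty word in which each letter occurs exactly twice or not at all. An assembly graph is a finite connected graph (loops and multiple edges allowed) whose vertices have degree $1$ or $4$ (a loop contributes $2$), with a fixed cyclic order (up to reversal) of the half-edges at each degree-$4$ vertex; half-edges adjacent in that order are neighbours. A simple assembly graph is one with a transverse path (from a degree-$1$ vertex to a degree-$1$ vertex, distinct edges, never leaving a vertex through a neighbour of the entering half-edge) traversing every edge exactly once; listing the degree-$4$ vertices along it gives a double occurrence word, and this gives a bijection between simple assembly graphs up to isomorphism and double occurrence words up to renaming and reversal. $\Gamma_w$ is the simple assembly graph of the word $w$. A polygonal path is a path with pairwise distinct degree-$4$ vertices in which consecutive edges are neighbours at the shared vertex (a single vertex counts). $\mathcal{C}(\Gamma)$ is the collection of sets of pairwise vertex-disjoint polygonal paths covering all degree-$4$ vertices. $F_k$ are Fibonacci numbers ($F_0=0,F_1=1$). A double occurrence word $w$ of length $2n$ is maximal if $|\mathcal{C}(\Gamma_w)|=F_{2n+1}-1$. -}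

module Defs where

open import Data.Nat using (ℕ; zero; suc; _+_; _≡ᵇ_; _≤ᵇ_)
open import Data.Bool using (Bool; true; false; _∧_; _∨_; not; if_then_else_)
open import Data.List using (List; []; _∷_; length; map; filterᵇ; concatMap; _++_)
open import Data.Bool.ListAction using (all; any)
open import Data.List.Relation.Unary.All using (All)
open import Data.Maybe using (Maybe; just; nothing)
open import Data.Product using (_×_; _,_)
open import Relation.Binary.PropositionalEquality using (_≡_; _≢_)

Word : Set
Word = List ℕ

occ : ℕ → Word → ℕ
occ a []       = 0
occ a (x ∷ xs) = if a ≡ᵇ x then suc (occ a xs) else occ a xs

IsDOW : Word → Set
IsDOW w = (w ≢ []) × All (λ a → occ a w ≡ 2) w

fib : ℕ → ℕ
fib zero          = 0
fib (suc zero)    = 1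
fib (suc (suc n)) = fib (suc n) + fib n

-- The simple assembly graph Γ_w of a word w of length m.
--
-- Degree-4 vertices: the letters of w.  Degree-1 vertices: start and end.
-- The transverse path visits  start, w[0], w[1], …, w[m-1], end, and its
-- edges are e_0, …, e_m, where e_k goes from position k-1 to position k
-- (position -1 = start, position m = end).
-- The tail of e_k sits at position k-1 ("outgoing" half-edge of that
-- occurrence), the head of e_k at position k ("incoming" half-edge).

data End : Set where
  tl hd : End

HalfEdge : Set
HalfEdge = ℕ × End

at : Word → ℕ → Maybe ℕ
at []       _       = nothing
at (x ∷ _)  zero    = just x
at (_ ∷ xs) (suc k) = at xs k

-- position of a half-edge (nothing = the start vertex)
pos : HalfEdge → Maybe ℕ
pos (zero  , tl) = nothing
pos (suc k , tl) = just k
pos (k     , hd) = just k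

-- vertex of a half-edge: just a = degree-4 vertex a, nothing = degree-1 vertex
vtx : Word → HalfEdge → Maybe ℕ
vtx w h with pos h
... | nothing = nothing
... | just p  = at w p

eqM : Maybe ℕ → Maybe ℕ → Bool
eqM (just a) (just b) = a ≡ᵇ b
eqM nothing  nothing  = true
eqM _        _        = false

isJust : Maybe ℕ → Bool
isJust (just _) = true
isJust nothing  = false

-- At the vertex of letter a, with
-- occurrences at positions p and q, the cyclic order of half-edges is
-- (in_p, in_q, out_p, out_q): the transverse path enters and leaves an
-- occurrence through opposite (non-neighbour) half-edges.  Hence two
-- distinct half-edges at the same degree-4 vertex are neighbours iff they
-- sit at different occurrences (positions).
neighbours : Word → HalfEdge → HalfEdge → Bool
neighbours w h h' with pos h | pos h'
... | just p | just q = isJust (at w p) ∧ eqM (at w p) (at w q) ∧ not (p ≡ᵇ q)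
... | _      | _      = false

-- Edge subsets of Γ_w: Boolean lists indexed by edge number 0..m.

bools : ℕ → List (List Bool)
bools zero    = [] ∷ []
bools (suc n) = map (true ∷_) (bools n) ++ map (false ∷_) (bools n)

chosen : List Bool → List ℕ
chosen = go 0
  where
  go : ℕ → List Bool → List ℕ
  go k []           = []
  go k (true  ∷ bs) = k ∷ go (suc k) bs
  go k (false ∷ bs) = go (suc k) bs

sub : List Bool → List Bool → Bool
sub []       []       = true
sub (t ∷ ts) (s ∷ ss) = (not t ∨ s) ∧ sub ts ss
sub _        _        = false

nonempty : List Bool → Bool
nonempty []       = false
nonempty (b ∷ bs) = b ∨ nonempty bs

incident : Word → List Bool → ℕ → List HalfEdge
incident w S a =
  filterᵇ (λ h → eqM (vtx w h) (just a))
          (concatMap (λ k → (k , tl) ∷ (k , hd) ∷ []) (chosen S))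

internalNonLoop : Word → ℕ → Bool
internalNonLoop w k with vtx w (k , tl) | vtx w (k , hd)
... | just a | just b = not (a ≡ᵇ b)
... | _      | _      = false

-- local condition at the vertex a: at most two S-half-edges, and if two,
-- they are neighbours (consecutive edges of a polygonal path)
localOK : Word → List Bool → ℕ → Bool
localOK w S a with incident w S a
... | []               = true
... | _ ∷ []           = true
... | h ∷ h' ∷ []      = neighbours w h h'
... | _ ∷ _ ∷ _ ∷ _    = false

-- S contains no cycle: every non-empty T ⊆ S has a vertex meeting T in
-- exactly one half-edge
acyclic : Word → List Bool → Bool
acyclic w S =
  all (λ T → not (sub T S ∧ nonempty T)
             ∨ any (λ a → length (incident w T a) ≡ᵇ 1) w)
      (bools (length S))

-- S is the (union of the) edge set(s) of a collection in 𝒞(Γ_w):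
-- the spanning subgraph of the degree-4 vertices with edge set S is a
-- vertex-disjoint union of polygonal paths (isolated vertices being
-- one-vertex paths).
isCover : Word → List Bool → Bool
isCover w S =
  all (internalNonLoop w) (chosen S) ∧ all (localOK w S) w ∧ acyclic w S

coverCount : Word → ℕ
coverCount w = length (filterᵇ (isCover w) (bools (suc (length w))))

{-# OPTIONS --safe #-}
-- Along the transverse path of Γ_w, with edges e_0, …, e_m (m = |w|), the consecutive
-- edges e_k and e_(k+1) meet at the same occurrence w[k], where they are not neighbours.
-- Hence the edge set of a cover avoids the end edges e_0, e_m and contains no two
-- consecutive edges, and there are F_(m+1) such sets. For w = uv, the sets
-- {e_1, e_3, …, e_(|u|−1)} and {e_(|u|+1), e_(|u|+3), …, e_(m−1)} are two of them, but every
-- vertex meets each of them in 0 or 2 half-edges, so they contain cycles. Thus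
-- |𝒞(Γ_w)| ≤ F_(m+1) − 2.
module Submission where

open import Defs
open import Data.Nat using (ℕ; zero; suc; _*_; _+_; _∸_; _≤_; _<_; z≤n; s≤s; _≡ᵇ_)
open import Data.Nat.Properties
  using (_≟_; +-suc; +-comm; ≤-refl; ≤-trans; n≤1+n; <⇒≢; <-irrefl; m+n≤o⇒m≤o∸n; +-monoʳ-≤;
         suc-injective; 1+n≢0; ≡ᵇ⇒≡; ≡⇒≡ᵇ)
open import Data.Bool using (Bool; true; false; _∧_; _∨_; not; T; T?; if_then_else_)
open import Data.Bool.Properties using (T-≡; T-∧)
open import Data.Bool.ListAction using (all; any)
open import Data.List using (List; []; _∷_; length; map; filterᵇ; concatMap; _++_; replicate)
open import Data.List.Properties using (length-++; length-replicate; filter-++; ++-identityʳ)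
open import Data.List.Membership.Propositional using (_∈_; _∉_; find; lose)
open import Data.List.Membership.Propositional.Properties
  using (∈-++⁺ˡ; ∈-++⁺ʳ; ∈-++⁻; ∈-map⁺; ∈-map⁻; ∈-filter⁺; ∈-filter⁻; ∈-concatMap⁺)
open import Data.List.Relation.Unary.All as All using (All; _∷_)
open import Data.List.Relation.Unary.All.Properties using (all⁺)
open import Data.List.Relation.Unary.Any using (here; there)
open import Data.List.Relation.Unary.Any.Properties using (any⁻)
open import Data.Maybe using (Maybe; just; nothing)
open import Data.Product using (∃-syntax; _×_; _,_; proj₂)
open import Data.Sum using (inj₁; inj₂)
open import Data.Empty using (⊥; ⊥-elim)
open import Data.Unit using (tt)
open import Function using (_∘_; Equivalence)
open import Relation.Nullary using (¬_; yes; no)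
open import Relation.Binary.PropositionalEquality
  using (_≡_; _≢_; refl; sym; trans; cong; cong₂; subst; module ≡-Reasoning)

open Equivalence using (to; from)

private
  variable
    A B : Set
    p q : A → Bool
    x y : A
    xs ys : List A

T-not-¬ : ∀ {b} → T (not b) → ¬ T b
T-not-¬ {false} _ ()

¬T⇒T-not : ∀ {b} → ¬ T b → T (not b)
¬T⇒T-not {true}  ¬b = ¬b tt
¬T⇒T-not {false} _  = tt

T-∧ˡ : ∀ x {y} → T (x ∧ y) → T x
T-∧ˡ true _ = tt

T-∧ʳ : ∀ x {y} → T (x ∧ y) → T y
T-∧ʳ true t = t

T-∨-not : ∀ {b c} → T b → T (not b ∨ c) → T c
T-∨-not {true} _ t = t

≡ᵇ-refl : ∀ n → (n ≡ᵇ n) ≡ true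
≡ᵇ-refl n = to T-≡ (≡⇒≡ᵇ n n refl)

≡ᵇ-sym : ∀ m n → (m ≡ᵇ n) ≡ (n ≡ᵇ m)
≡ᵇ-sym zero    zero    = refl
≡ᵇ-sym zero    (suc n) = refl
≡ᵇ-sym (suc m) zero    = refl
≡ᵇ-sym (suc m) (suc n) = ≡ᵇ-sym m n

countᵇ : (A → Bool) → List A → ℕ
countᵇ p xs = length (filterᵇ p xs)

countᵇ-++ : ∀ (p : A → Bool) xs ys → countᵇ p (xs ++ ys) ≡ countᵇ p xs + countᵇ p ys
countᵇ-++ p xs ys = trans (cong length (filter-++ (T? ∘ p) xs ys)) (length-++ (filterᵇ p xs))

countᵇ-map : ∀ (p : B → Bool) (f : A → B) xs → countᵇ p (map f xs) ≡ countᵇ (p ∘ f) xs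
countᵇ-map p f []       = refl
countᵇ-map p f (x ∷ xs) with p (f x)
... | true  = cong suc (countᵇ-map p f xs)
... | false = countᵇ-map p f xs

countᵇ-none : ∀ (xs : List A) → countᵇ (λ _ → false) xs ≡ 0
countᵇ-none []       = refl
countᵇ-none (x ∷ xs) = countᵇ-none xs

countᵇ-split : (∀ {x} → x ∈ xs → T (p x) → T (q x)) →
               countᵇ q xs ≡ countᵇ p xs + countᵇ (λ x → q x ∧ not (p x)) xs
countᵇ-split {xs = []}               p⇒q = refl
countᵇ-split {xs = x ∷ xs} {p} {q} p⇒q with ih ← countᵇ-split (p⇒q ∘ there) | p x in px | q x in qx
... | true  | true  = cong suc ih
... | true  | false = ⊥-elim (subst T qx (p⇒q (here refl) (from T-≡ px)))
... | false | true  = trans (cong suc ih) (sym (+-suc _ _))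
... | false | false = ih

two≤length : x ∈ xs → y ∈ xs → x ≢ y → 2 ≤ length xs
two≤length {xs = _ ∷ _ ∷ _} _          _          _   = s≤s (s≤s z≤n)
two≤length {xs = _ ∷ []}    (here refl) (here refl) x≢y = ⊥-elim (x≢y refl)

countᵇ-gap : (∀ {x} → x ∈ xs → T (p x) → T (q x)) →
             x ∈ xs → y ∈ xs → x ≢ y →
             T (q x) → ¬ T (p x) → T (q y) → ¬ T (p y) →
             countᵇ p xs + 2 ≤ countᵇ q xs
countᵇ-gap {xs = xs} {p} {q} p⇒q x∈xs y∈xs x≢y qx ¬px qy ¬py =
  subst (countᵇ p xs + 2 ≤_) (sym (countᵇ-split p⇒q))
        (+-monoʳ-≤ (countᵇ p xs) (two≤length (gapped x∈xs qx ¬px) (gapped y∈xs qy ¬py) x≢y))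
  where
  gapped : ∀ {z} → z ∈ xs → T (q z) → ¬ T (p z) → z ∈ filterᵇ (λ x → q x ∧ not (p x)) xs
  gapped z∈xs qz ¬pz = ∈-filter⁺ (T? ∘ λ x → q x ∧ not (p x)) z∈xs (from T-∧ (qz , ¬T⇒T-not ¬pz))

∈-bools : ∀ S → S ∈ bools (length S)
∈-bools []          = here refl
∈-bools (true  ∷ S) = ∈-++⁺ˡ (∈-map⁺ (true ∷_) (∈-bools S))
∈-bools (false ∷ S) = ∈-++⁺ʳ _ (∈-map⁺ (false ∷_) (∈-bools S))

∈-bools⇒length : ∀ n {S} → S ∈ bools n → length S ≡ n
∈-bools⇒length zero    (here refl) = refl
∈-bools⇒length (suc n) S∈ with ∈-++⁻ (map (true ∷_) (bools n)) S∈
... | inj₁ S∈ˡ with _ , S′∈ , refl ← ∈-map⁻ (true ∷_) S∈ˡ  = cong suc (∈-bools⇒length n S′∈)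
... | inj₂ S∈ʳ with _ , S′∈ , refl ← ∈-map⁻ (false ∷_) S∈ʳ = cong suc (∈-bools⇒length n S′∈)

countᵇ-bools-suc : ∀ (p : List Bool → Bool) n →
  countᵇ p (bools (suc n)) ≡ countᵇ (p ∘ (true ∷_)) (bools n) + countᵇ (p ∘ (false ∷_)) (bools n)
countᵇ-bools-suc p n = begin
  countᵇ p (map (true ∷_) (bools n) ++ map (false ∷_) (bools n))
    ≡⟨ countᵇ-++ p (map (true ∷_) (bools n)) _ ⟩
  countᵇ p (map (true ∷_) (bools n)) + countᵇ p (map (false ∷_) (bools n))
    ≡⟨ cong₂ _+_ (countᵇ-map p (true ∷_) (bools n)) (countᵇ-map p (false ∷_) (bools n)) ⟩
  countᵇ (p ∘ (true ∷_)) (bools n) + countᵇ (p ∘ (false ∷_)) (bools n) ∎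
  where open ≡-Reasoning

-- Spaced bit strings and Fibonacci numbers

-- Every true is immediately followed by a false, so the spaced strings of length n
-- are the tilings of a strip of length n by [false] and [true, false].
spaced : List Bool → Bool
spaced []                  = true
spaced (false ∷ bs)        = spaced bs
spaced (true ∷ false ∷ bs) = spaced bs
spaced (true ∷ true ∷ _)   = false
spaced (true ∷ [])         = false

countᵇ-spaced : ∀ n → countᵇ spaced (bools n) ≡ fib (suc n)
countᵇ-spaced zero          = refl
countᵇ-spaced (suc zero)    = refl
countᵇ-spaced (suc (suc n)) = begin
  countᵇ spaced (bools (2 + n))
    ≡⟨ countᵇ-bools-suc spaced (suc n) ⟩
  countᵇ (spaced ∘ (true ∷_)) (bools (suc n)) + countᵇ spaced (bools (suc n))
    ≡⟨ cong (_+ countᵇ spaced (bools (suc n))) (countᵇ-bools-suc (spaced ∘ (true ∷_)) n) ⟩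
  (countᵇ (λ _ → false) (bools n) + countᵇ spaced (bools n)) + countᵇ spaced (bools (suc n))
    ≡⟨ cong₂ _+_ (cong₂ _+_ (countᵇ-none (bools n)) (countᵇ-spaced n)) (countᵇ-spaced (suc n)) ⟩
  fib (suc n) + fib (2 + n)
    ≡⟨ +-comm (fib (suc n)) _ ⟩
  fib (3 + n) ∎
  where open ≡-Reasoning

-- As an edge set of e_0, …, e_m: neither e_0 nor e_m, and no two consecutive edges.
innerSpaced : List Bool → Bool
innerSpaced (false ∷ bs) = spaced bs
innerSpaced _            = false

countᵇ-innerSpaced : ∀ n → countᵇ innerSpaced (bools (suc n)) ≡ fib (suc n)
countᵇ-innerSpaced n = begin
  countᵇ innerSpaced (bools (suc n))
    ≡⟨ countᵇ-bools-suc innerSpaced n ⟩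
  countᵇ (λ _ → false) (bools n) + countᵇ spaced (bools n)
    ≡⟨ cong₂ _+_ (countᵇ-none (bools n)) (countᵇ-spaced n) ⟩
  fib (suc n) ∎
  where open ≡-Reasoning

occ-here : ∀ a xs → occ a (a ∷ xs) ≡ suc (occ a xs)
occ-here a xs rewrite ≡ᵇ-refl a = refl

occ-there : ∀ {a x} xs → a ≢ x → occ a (x ∷ xs) ≡ occ a xs
occ-there {a} {x} xs a≢x with a ≡ᵇ x in a≡ᵇx
... | true  = ⊥-elim (a≢x (≡ᵇ⇒≡ a x (from T-≡ a≡ᵇx)))
... | false = refl

occ≡countᵇ : ∀ a xs → occ a xs ≡ countᵇ (_≡ᵇ a) xs
occ≡countᵇ a []       = refl
occ≡countᵇ a (x ∷ xs) rewrite ≡ᵇ-sym a x with x ≡ᵇ a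
... | true  = cong suc (occ≡countᵇ a xs)
... | false = occ≡countᵇ a xs

occ≢0⇒∈ : ∀ {a} xs → occ a xs ≢ 0 → a ∈ xs
occ≢0⇒∈         []       occ≢0 = ⊥-elim (occ≢0 refl)
occ≢0⇒∈ {a} (x ∷ xs) occ≢0 with a ≟ x
... | yes refl = here refl
... | no  a≢x  = there (occ≢0⇒∈ xs (occ≢0 ∘ trans (occ-there xs a≢x)))

twice⇒occ≢1 : ∀ {a xs} → All (λ b → occ b xs ≡ 2) xs → occ a xs ≢ 1
twice⇒occ≢1 {xs = xs} twice once
  with () ← trans (sym once) (All.lookup twice (occ≢0⇒∈ xs (1+n≢0 ∘ trans (sym once))))

deleteAll : ℕ → Word → Word
deleteAll x = filterᵇ (λ y → not (x ≡ᵇ y))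

length-deleteAll : ∀ x ys → length ys ≡ occ x ys + length (deleteAll x ys)
length-deleteAll x []       = refl
length-deleteAll x (y ∷ ys) with x ≡ᵇ y
... | true  = cong suc (length-deleteAll x ys)
... | false = trans (cong suc (length-deleteAll x ys)) (sym (+-suc _ _))

occ-deleteAll : ∀ {x a} ys → x ≢ a → occ a (deleteAll x ys) ≡ occ a ys
occ-deleteAll          []       _   = refl
occ-deleteAll {x} {a} (y ∷ ys) x≢a with x ≡ᵇ y in x≡ᵇy
... | true  = trans (occ-deleteAll ys x≢a)
                    (sym (occ-there ys λ a≡y → x≢a (trans (≡ᵇ⇒≡ x y (from T-≡ x≡ᵇy)) (sym a≡y))))
... | false = cong (λ n → if a ≡ᵇ y then suc n else n) (occ-deleteAll ys x≢a)

∈-deleteAll⁻ : ∀ {a x} ys → a ∈ deleteAll x ys → a ∈ ys × x ≢ a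
∈-deleteAll⁻ {a} {x} ys a∈ with a∈ys , kept ← ∈-filter⁻ (T? ∘ λ y → not (x ≡ᵇ y)) a∈ =
  a∈ys , λ { refl → T-not-¬ kept (≡⇒≡ᵇ x x refl) }

twice⇒even-length-≤ : ∀ n {xs} → length xs ≤ n → All (λ a → occ a xs ≡ 2) xs → ∃[ i ] length xs ≡ i + i
twice⇒even-length-≤ _       {[]}     _           _                      = 0 , refl
twice⇒even-length-≤ (suc n) {x ∷ ys} (s≤s |ys|≤n) (twice-x ∷ twice-ys)
  = let i , |zs|≡2i = twice⇒even-length-≤ n |zs|≤n twice-zs in suc i , (begin
      suc (length ys)        ≡⟨ cong suc |ys|≡ ⟩
      suc (suc (length zs))  ≡⟨ cong (suc ∘ suc) |zs|≡2i ⟩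
      suc (suc (i + i))      ≡⟨ cong suc (sym (+-suc i i)) ⟩
      suc i + suc i          ∎)
  where
  open ≡-Reasoning
  zs : Word
  zs = deleteAll x ys

  |ys|≡ : length ys ≡ suc (length zs)
  |ys|≡ = trans (length-deleteAll x ys)
                (cong (_+ length zs) (suc-injective (trans (sym (occ-here x ys)) twice-x)))

  |zs|≤n : length zs ≤ n
  |zs|≤n = ≤-trans (n≤1+n _) (subst (_≤ n) |ys|≡ |ys|≤n)

  twice-zs : All (λ a → occ a zs ≡ 2) zs
  twice-zs = All.tabulate λ a∈ → let a∈ys , x≢a = ∈-deleteAll⁻ ys a∈ in
    trans (occ-deleteAll ys x≢a) (trans (sym (occ-there ys (x≢a ∘ sym))) (All.lookup twice-ys a∈ys))

IsDOW⇒even-length : ∀ {w} → IsDOW w → ∃[ i ] length w ≡ suc i + suc i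
IsDOW⇒even-length {[]}    ([]≢[] , _) = ⊥-elim ([]≢[] refl)
IsDOW⇒even-length {x ∷ w} (_ , twice) with twice⇒even-length-≤ _ ≤-refl twice
... | suc i , |w|≡ = i , |w|≡

-- Edge sets of covers

indicesFrom : ℕ → List Bool → List ℕ
indicesFrom k []           = []
indicesFrom k (true  ∷ bs) = k ∷ indicesFrom (suc k) bs
indicesFrom k (false ∷ bs) = indicesFrom (suc k) bs

indicesFrom-unique : (f : ℕ → List Bool → List ℕ) →
  (∀ k → f k [] ≡ []) →
  (∀ k bs → f k (true ∷ bs) ≡ k ∷ f (suc k) bs) →
  (∀ k bs → f k (false ∷ bs) ≡ f (suc k) bs) →
  ∀ k bs → f k bs ≡ indicesFrom k bs
indicesFrom-unique f nil cons skip k []           = nil k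
indicesFrom-unique f nil cons skip k (true  ∷ bs) =
  trans (cons k bs) (cong (k ∷_) (indicesFrom-unique f nil cons skip (suc k) bs))
indicesFrom-unique f nil cons skip k (false ∷ bs) =
  trans (skip k bs) (indicesFrom-unique f nil cons skip (suc k) bs)

-- `chosen` is `go 0` for a helper `go` local to its where block; abstracting
-- the offset 0 lets unification name `go` as the function f above.
chosen≡indicesFrom : ∀ S → chosen S ≡ indicesFrom 0 S
chosen≡indicesFrom with 0 | indicesFrom-unique _ (λ _ → refl) (λ _ _ → refl) (λ _ _ → refl)
... | k | unique = unique k

nonConsecutive⇒spaced : ∀ o S →
  (∀ {k} → k ∈ indicesFrom o S → suc k ∈ indicesFrom o S → ⊥) →
  (∀ {k} → k ∈ indicesFrom o S → suc k < o + length S) →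
  T (spaced S)
nonConsecutive⇒spaced o []                  _       _       = tt
nonConsecutive⇒spaced o (false ∷ S)         noPair  bounded =
  nonConsecutive⇒spaced (suc o) S noPair
    (λ {k} k∈ → subst (suc k <_) (+-suc o (length S)) (bounded k∈))
nonConsecutive⇒spaced o (true ∷ false ∷ S)  noPair  bounded =
  nonConsecutive⇒spaced (suc (suc o)) S
    (λ k∈ sk∈ → noPair (there k∈) (there sk∈))
    (λ {k} k∈ → subst (suc k <_) (trans (+-suc o _) (cong suc (+-suc o (length S))))
                                 (bounded (there k∈)))
nonConsecutive⇒spaced o (true ∷ true ∷ S)   noPair  _       = noPair (here refl) (there (here refl))
nonConsecutive⇒spaced o (true ∷ [])         _       bounded =
  <-irrefl (sym (+-comm o 1)) (bounded (here refl))

pos-hd : ∀ k → pos (k , hd) ≡ just k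
pos-hd zero    = refl
pos-hd (suc k) = refl

vtx-hd : ∀ w k → vtx w (k , hd) ≡ at w k
vtx-hd w zero    = refl
vtx-hd w (suc k) = refl

at⇒< : ∀ w k {a} → at w k ≡ just a → k < length w
at⇒< (_ ∷ _) zero    _  = s≤s z≤n
at⇒< (_ ∷ w) (suc k) wk = s≤s (at⇒< w k wk)

at⇒∈ : ∀ w k {a} → at w k ≡ just a → a ∈ w
at⇒∈ (_ ∷ _) zero    refl = here refl
at⇒∈ (_ ∷ w) (suc k) wk   = there (at⇒∈ w k wk)

internalNonLoop⇒at : ∀ w k → T (internalNonLoop w k) → ∃[ a ] at w k ≡ just a
internalNonLoop⇒at w k internal with vtx w (k , tl) | vtx w (k , hd) in head
... | just _  | just b  = b , trans (sym (vtx-hd w k)) head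
... | just _  | nothing = ⊥-elim internal
... | nothing | _       = ⊥-elim internal

neighbours-samePos : ∀ w {h h′ k} → pos h ≡ just k → pos h′ ≡ just k → ¬ T (neighbours w h h′)
neighbours-samePos w {h} {h′} hk h′k with pos h | pos h′
neighbours-samePos w {k = k} refl refl | just .k | just .k =
  λ nb → T-not-¬ (T-∧ʳ (eqM (at w k) (at w k)) (T-∧ʳ (isJust (at w k)) nb)) (≡⇒≡ᵇ k k refl)

localOK⇒distinctPos : ∀ w S a {h h′ k} → T (localOK w S a) →
  h ∈ incident w S a → h′ ∈ incident w S a → h ≢ h′ → pos h ≡ just k → pos h′ ≡ just k → ⊥
localOK⇒distinctPos w S a ok h∈ h′∈ h≢h′ hk h′k with incident w S a
... | _ ∷ [] with h∈ | h′∈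
...   | here refl | here refl = h≢h′ refl
localOK⇒distinctPos w S a ok h∈ h′∈ h≢h′ hk h′k | _ ∷ _ ∷ [] with h∈ | h′∈
...   | here refl         | here refl         = h≢h′ refl
...   | there (here refl) | there (here refl) = h≢h′ refl
...   | here refl         | there (here refl) = neighbours-samePos w hk h′k ok
...   | there (here refl) | here refl         = neighbours-samePos w h′k hk ok
localOK⇒distinctPos w S a ok h∈ h′∈ h≢h′ hk h′k | _ ∷ _ ∷ _ ∷ _ = ok

halves : ℕ → List HalfEdge
halves k = (k , tl) ∷ (k , hd) ∷ []

∈-incident : ∀ w S {a k h} → k ∈ chosen S → h ∈ halves k → vtx w h ≡ just a → h ∈ incident w S a
∈-incident w S {a} k∈ h∈ vh =
  ∈-filter⁺ (T? ∘ λ h → eqM (vtx w h) (just a)) (∈-concatMap⁺ halves (lose k∈ h∈))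
            (subst (λ m → T (eqM m (just a))) (sym vh) (≡⇒≡ᵇ a a refl))

module _ (w : Word) (S : List Bool) (cover : T (isCover w S)) where

  private
    local∧acyclic : T (all (localOK w S) w ∧ acyclic w S)
    local∧acyclic = T-∧ʳ (all (internalNonLoop w) (chosen S)) cover

  cover⇒internalNonLoop : ∀ {k} → k ∈ chosen S → T (internalNonLoop w k)
  cover⇒internalNonLoop =
    All.lookup (all⁺ (internalNonLoop w) (chosen S) (T-∧ˡ (all (internalNonLoop w) (chosen S)) cover))

  cover⇒localOK : ∀ {a} → a ∈ w → T (localOK w S a)
  cover⇒localOK = All.lookup (all⁺ (localOK w S) w (T-∧ˡ (all (localOK w S) w) local∧acyclic))

  cover⇒leaf : ∀ {U} → U ∈ bools (length S) → T (sub U S ∧ nonempty U) →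
               T (any (λ a → length (incident w U a) ≡ᵇ 1) w)
  cover⇒leaf U∈ U⊆S =
    T-∨-not U⊆S (All.lookup (all⁺ noCycleAt (bools (length S)) acyclic-S) U∈)
    where
    acyclic-S : T (acyclic w S)
    acyclic-S = T-∧ʳ (all (localOK w S) w) local∧acyclic

    noCycleAt : List Bool → Bool
    noCycleAt U = not (sub U S ∧ nonempty U) ∨ any (λ a → length (incident w U a) ≡ᵇ 1) w

cover⇒innerSpaced : ∀ w S → length S ≡ suc (length w) → T (isCover w S) → T (innerSpaced S)
cover⇒innerSpaced w (true ∷ S)  _   cover = cover⇒internalNonLoop w (true ∷ S) cover (here refl)
cover⇒innerSpaced w (false ∷ S) len cover = nonConsecutive⇒spaced 1 S noPair bounded
  where
  chosen-S : ∀ {k} → k ∈ indicesFrom 1 S → k ∈ chosen (false ∷ S)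
  chosen-S = subst (_ ∈_) (sym (chosen≡indicesFrom (false ∷ S)))

  letter : ∀ {k} → k ∈ indicesFrom 1 S → ∃[ a ] at w k ≡ just a
  letter k∈ = internalNonLoop⇒at w _ (cover⇒internalNonLoop w (false ∷ S) cover (chosen-S k∈))

  bounded : ∀ {k} → k ∈ indicesFrom 1 S → suc k < 1 + length S
  bounded {k} k∈ = s≤s (subst (k <_) (sym (suc-injective len)) (at⇒< w k (proj₂ (letter k∈))))

  noPair : ∀ {k} → k ∈ indicesFrom 1 S → suc k ∈ indicesFrom 1 S → ⊥
  noPair {k} k∈ sk∈ with a , wk ← letter k∈ =
    localOK⇒distinctPos w (false ∷ S) a (cover⇒localOK w (false ∷ S) cover (at⇒∈ w k wk))
      (∈-incident w (false ∷ S) (chosen-S k∈) (there (here refl)) (trans (vtx-hd w k) wk))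
      (∈-incident w (false ∷ S) (chosen-S sk∈) (here refl) wk)
      (λ ()) (pos-hd k) refl

-- Pairings are not covers

sub-refl : ∀ S → T (sub S S)
sub-refl []          = tt
sub-refl (true  ∷ S) = sub-refl S
sub-refl (false ∷ S) = sub-refl S

leafless⇒¬isCover : ∀ w S → T (nonempty S) → (∀ {a} → a ∈ w → length (incident w S a) ≢ 1) →
                    ¬ T (isCover w S)
leafless⇒¬isCover w S nonempty-S leafless cover
  with _ , a∈w , leaf ← find (any⁻ _ w (cover⇒leaf w S cover (∈-bools S)
                                          (from T-∧ (sub-refl S , nonempty-S))))
  = leafless a∈w (≡ᵇ⇒≡ _ 1 leaf)

alternating : ℕ → List Bool
alternating zero    = []
alternating (suc i) = true ∷ false ∷ alternating i

-- The edges e_(l+1), e_(l+3), …, e_(l+2i−1) of Γ_w, where |w| = l + 2i + r; they pair up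
-- the positions l, …, l+2i−1.
pairing : ℕ → ℕ → ℕ → List Bool
pairing l i r = false ∷ replicate l false ++ alternating i ++ replicate r false

length-alternating : ∀ i → length (alternating i) ≡ i + i
length-alternating zero    = refl
length-alternating (suc i) = cong suc (trans (cong suc (length-alternating i)) (sym (+-suc i i)))

pairing∈bools : ∀ (p : Word) {x} s {i} → length x ≡ i + i →
                pairing (length p) i (length s) ∈ bools (suc (length (p ++ x ++ s)))
pairing∈bools p {x} s {i} |x|≡2i = subst (λ n → _ ∈ bools (suc n)) |pairing| (∈-bools _)
  where
  open ≡-Reasoning
  |pairing| : length (replicate (length p) false ++ alternating i ++ replicate (length s) false)
            ≡ length (p ++ x ++ s)
  |pairing| = begin
    length (replicate (length p) false ++ alternating i ++ replicate (length s) false)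
      ≡⟨ length-++ (replicate (length p) false) ⟩
    length (replicate (length p) false) + length (alternating i ++ replicate (length s) false)
      ≡⟨ cong₂ _+_ (length-replicate (length p)) (length-++ (alternating i)) ⟩
    length p + (length (alternating i) + length (replicate (length s) false))
      ≡⟨ cong (length p +_) (cong₂ _+_ (trans (length-alternating i) (sym |x|≡2i))
                                         (length-replicate (length s))) ⟩
    length p + (length x + length s)
      ≡⟨ cong (length p +_) (sym (length-++ x)) ⟩
    length p + length (x ++ s)
      ≡⟨ sym (length-++ p) ⟩
    length (p ++ x ++ s) ∎

spaced-replicate-++ : ∀ l bs → spaced (replicate l false ++ bs) ≡ spaced bs
spaced-replicate-++ zero    bs = refl
spaced-replicate-++ (suc l) bs = spaced-replicate-++ l bs

spaced-alternating-++ : ∀ i bs → spaced (alternating i ++ bs) ≡ spaced bs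
spaced-alternating-++ zero    bs = refl
spaced-alternating-++ (suc i) bs = spaced-alternating-++ i bs

spaced-replicate : ∀ r → T (spaced (replicate r false))
spaced-replicate zero    = tt
spaced-replicate (suc r) = spaced-replicate r

innerSpaced-pairing : ∀ l i r → T (innerSpaced (pairing l i r))
innerSpaced-pairing l i r =
  subst T (sym (trans (spaced-replicate-++ l _) (spaced-alternating-++ i _))) (spaced-replicate r)

nonempty-pairing : ∀ l i r → T (nonempty (pairing l (suc i) r))
nonempty-pairing zero    i r = tt
nonempty-pairing (suc l) i r = nonempty-pairing l i r

indicesFrom-replicate-++ : ∀ o l bs → indicesFrom o (replicate l false ++ bs) ≡ indicesFrom (l + o) bs
indicesFrom-replicate-++ o zero    bs = refl
indicesFrom-replicate-++ o (suc l) bs =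
  trans (indicesFrom-replicate-++ (suc o) l bs) (cong (λ k → indicesFrom k bs) (+-suc l o))

indicesFrom-replicate : ∀ o r → indicesFrom o (replicate r false) ≡ []
indicesFrom-replicate o zero    = refl
indicesFrom-replicate o (suc r) = indicesFrom-replicate (suc o) r

endpoints : Word → List ℕ → List (Maybe ℕ)
endpoints w ks = map (vtx w) (concatMap halves ks)

endpoints-shift : ∀ y w o S →
  endpoints (y ∷ w) (indicesFrom (2 + o) S) ≡ endpoints w (indicesFrom (1 + o) S)
endpoints-shift y w o []          = refl
endpoints-shift y w o (true  ∷ S) =
  cong (λ vs → at w o ∷ at w (suc o) ∷ vs) (endpoints-shift y w (suc o) S)
endpoints-shift y w o (false ∷ S) = endpoints-shift y w (suc o) S

endpoints-++ : ∀ p w S →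
  endpoints (p ++ w) (indicesFrom (suc (length p)) S) ≡ endpoints w (indicesFrom 1 S)
endpoints-++ []      w S = refl
endpoints-++ (y ∷ p) w S = trans (endpoints-shift y (p ++ w) (length p) S) (endpoints-++ p w S)

endpoints-alternating : ∀ x s i r → length x ≡ i + i →
  endpoints (x ++ s) (indicesFrom 1 (alternating i ++ replicate r false)) ≡ map just x
endpoints-alternating []          s zero    r _     = cong (endpoints s) (indicesFrom-replicate 1 r)
endpoints-alternating (a ∷ [])    s (suc i) r |x|≡  with () ← trans (suc-injective |x|≡) (+-suc i i)
endpoints-alternating (a ∷ b ∷ x) s (suc i) r |x|≡  = cong (λ vs → just a ∷ just b ∷ vs) (begin
  endpoints (a ∷ b ∷ x ++ s) (indicesFrom 3 rest)  ≡⟨ endpoints-shift a (b ∷ x ++ s) 1 rest ⟩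
  endpoints (b ∷ x ++ s) (indicesFrom 2 rest)      ≡⟨ endpoints-shift b (x ++ s) 0 rest ⟩
  endpoints (x ++ s) (indicesFrom 1 rest)          ≡⟨ endpoints-alternating x s i r |x′|≡ ⟩
  map just x                                       ∎)
  where
  open ≡-Reasoning
  rest = alternating i ++ replicate r false
  |x′|≡ : length x ≡ i + i
  |x′|≡ = suc-injective (trans (suc-injective |x|≡) (+-suc i i))

endpoints-pairing : ∀ p {x} s {i} → length x ≡ i + i →
  endpoints (p ++ x ++ s) (chosen (pairing (length p) i (length s))) ≡ map just x
endpoints-pairing p {x} s {i} |x|≡2i = begin
  endpoints (p ++ x ++ s) (chosen (pairing (length p) i (length s)))
    ≡⟨ cong (endpoints (p ++ x ++ s)) (chosen≡indicesFrom (pairing (length p) i (length s))) ⟩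
  endpoints (p ++ x ++ s) (indicesFrom 1 (replicate (length p) false ++ rest))
    ≡⟨ cong (endpoints (p ++ x ++ s)) (indicesFrom-replicate-++ 1 (length p) rest) ⟩
  endpoints (p ++ x ++ s) (indicesFrom (length p + 1) rest)
    ≡⟨ cong (λ k → endpoints (p ++ x ++ s) (indicesFrom k rest)) (+-comm (length p) 1) ⟩
  endpoints (p ++ x ++ s) (indicesFrom (suc (length p)) rest)
    ≡⟨ endpoints-++ p (x ++ s) rest ⟩
  endpoints (x ++ s) (indicesFrom 1 rest)
    ≡⟨ endpoints-alternating x s i (length s) |x|≡2i ⟩
  map just x ∎
  where
  open ≡-Reasoning
  rest = alternating i ++ replicate (length s) false

length-incident-pairing : ∀ p {x} s {i} a → length x ≡ i + i →
  length (incident (p ++ x ++ s) (pairing (length p) i (length s)) a) ≡ occ a x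
length-incident-pairing p {x} s {i} a |x|≡2i = begin
  length (incident (p ++ x ++ s) S a)
    ≡⟨ sym (countᵇ-map atA (vtx (p ++ x ++ s)) (concatMap halves (chosen S))) ⟩
  countᵇ atA (endpoints (p ++ x ++ s) (chosen S))
    ≡⟨ cong (countᵇ atA) (endpoints-pairing p s |x|≡2i) ⟩
  countᵇ atA (map just x)
    ≡⟨ countᵇ-map atA just x ⟩
  countᵇ (_≡ᵇ a) x
    ≡⟨ sym (occ≡countᵇ a x) ⟩
  occ a x ∎
  where
  open ≡-Reasoning
  S = pairing (length p) i (length s)
  atA : Maybe ℕ → Bool
  atA m = eqM m (just a)

pairing-¬isCover : ∀ p {x} s {i} → All (λ a → occ a x ≡ 2) x → length x ≡ suc i + suc i →
  ¬ T (isCover (p ++ x ++ s) (pairing (length p) (suc i) (length s)))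
pairing-¬isCover p {x} s {i} twice |x|≡ =
  leafless⇒¬isCover (p ++ x ++ s) (pairing (length p) (suc i) (length s))
    (nonempty-pairing (length p) i (length s))
    (λ {a} _ → twice⇒occ≢1 twice ∘ trans (sym (length-incident-pairing p s a |x|≡)))

coverCount-+++2≤fib : ∀ {u v i j} → All (λ a → occ a u ≡ 2) u → All (λ a → occ a v ≡ 2) v →
  length u ≡ suc i + suc i → length v ≡ suc j + suc j →
  coverCount (u ++ v) + 2 ≤ fib (suc (length (u ++ v)))
coverCount-+++2≤fib {u} {v} {i} {j} u-twice v-twice |u|≡ |v|≡ =
  subst (coverCount (u ++ v) + 2 ≤_) (countᵇ-innerSpaced (length (u ++ v)))
    (countᵇ-gap (λ {S} S∈ → cover⇒innerSpaced (u ++ v) S (∈-bools⇒length _ S∈))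
      Su∈ Sv∈ Su≢Sv
      (innerSpaced-pairing 0 (suc i) (length v)) (pairing-¬isCover [] v u-twice |u|≡)
      (innerSpaced-pairing (length u) (suc j) 0) Sv-¬cover)
  where
  Su Sv : List Bool
  Su = pairing 0 (suc i) (length v)
  Sv = pairing (length u) (suc j) 0

  u++v++[] : u ++ v ++ [] ≡ u ++ v
  u++v++[] = cong (u ++_) (++-identityʳ v)

  Su∈ : Su ∈ bools (suc (length (u ++ v)))
  Su∈ = pairing∈bools [] {u} v |u|≡

  Sv∈ : Sv ∈ bools (suc (length (u ++ v)))
  Sv∈ = subst (λ w → Sv ∈ bools (suc (length w))) u++v++[] (pairing∈bools u [] |v|≡)

  Sv-¬cover : ¬ T (isCover (u ++ v) Sv)
  Sv-¬cover = subst (λ w → ¬ T (isCover w Sv)) u++v++[] (pairing-¬isCover u [] v-twice |v|≡)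

  Su≢Sv : Su ≢ Sv
  Su≢Sv = subst (λ l → Su ≢ pairing l (suc j) 0) (sym |u|≡) (λ ())

m+2≤n⇒m≢n∸1 : ∀ {m n} → m + 2 ≤ n → m ≢ n ∸ 1
m+2≤n⇒m≢n∸1 {m} {n} m+2≤n = <⇒≢ (m+n≤o⇒m≤o∸n (suc m) (subst (_≤ n) (+-suc m 1) m+2≤n))

corollary3p10 : (u v : Word) → IsDOW u → IsDOW v →
    (∀ a → a ∈ u → a ∉ v) →
    (n : ℕ) → length (u ++ v) ≡ 2 * n →
    coverCount (u ++ v) ≢ fib (2 * n + 1) ∸ 1
corollary3p10 u v u-dow v-dow _ n |uv|≡2n
  with _ , |u|≡ ← IsDOW⇒even-length u-dow | _ , |v|≡ ← IsDOW⇒even-length v-dow =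
  m+2≤n⇒m≢n∸1 (subst (λ m → coverCount (u ++ v) + 2 ≤ fib m)
                      (trans (cong suc |uv|≡2n) (+-comm 1 (2 * n)))
                      (coverCount-+++2≤fib (proj₂ u-dow) (proj₂ v-dow) |u|≡ |v|≡))
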